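{- There exist infinitely many pairwise non-isomorphic finite simple graphs $G$ such that $G$ is Hamiltonian, $G$ can be embedded on the torus, $G$ contains no subgraph isomorphic to $K_5^-$, and $G$ has chromatic number exactly $5$.
   Context: $K_5^-$ denotes the complete graph $K_5$ with one edge removed. A graph is Hamiltonian if it contains a cycle through all its vertices. -}

module Defs where

open import Data.Nat using (ℕ; zero; suc; _+_; _*_; _≤_; _<_; _≤ᵇ_)
open import Data.Fin using (Fin; toℕ; inject₁; fromℕ) renaming (zero to fzero; suc to fsuc)
open import Data.Bool using (Bool; true; false; T; _∧_)
open import Data.Product using (Σ; ∃; ∃-syntax; _×_; _,_; proj₁; proj₂)
open import Data.List using (List; []; _∷_; length; filter; allFin; cartesianProduct; upTo)
open import Relation.Binary.PropositionalEquality using (_≡_; _≢_)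
open import Relation.Nullary using (¬_)
open import Function.Bundles using (_↔_; Inverse)
open import Function.Definitions using (Injective)

record Graph (n : ℕ) : Set where
  field
    adj    : Fin n → Fin n → Bool
    sym    : ∀ u v → adj u v ≡ adj v u
    irrefl : ∀ u → adj u u ≡ false
open Graph public

Adj : ∀ {n} → Graph n → Fin n → Fin n → Set
Adj G u v = adj G u v ≡ true

Iso : ∀ {n m} → Graph n → Graph m → Set
Iso {n} {m} G H =
  Σ (Fin n ↔ Fin m) λ f → ∀ u v → adj H (Inverse.to f u) (Inverse.to f v) ≡ adj G u v

-- Subgraphs: H is isomorphic to a (not necessarily induced) subgraph of G
-- iff there is an injective map V(H) → V(G) sending edges to edges.

ContainsSubgraph : ∀ {n k} → Graph n → Graph k → Set
ContainsSubgraph {n} {k} G H =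
  Σ (Fin k → Fin n) λ f → Injective _≡_ _≡_ f × (∀ u v → Adj H u v → Adj G (f u) (f v))

k5⁻adj : Fin 5 → Fin 5 → Bool
k5⁻adj fzero fzero = false
k5⁻adj fzero (fsuc fzero) = false
k5⁻adj (fsuc fzero) fzero = false
k5⁻adj (fsuc fzero) (fsuc fzero) = false
k5⁻adj fzero (fsuc (fsuc _)) = true
k5⁻adj (fsuc fzero) (fsuc (fsuc _)) = true
k5⁻adj (fsuc (fsuc _)) fzero = true
k5⁻adj (fsuc (fsuc _)) (fsuc fzero) = true
k5⁻adj (fsuc (fsuc i)) (fsuc (fsuc j)) with Data.Fin._≟_ i j
... | Relation.Nullary.yes _ = false
... | Relation.Nullary.no  _ = true

private
  open import Data.Fin using (_≟_)
  open import Relation.Binary.PropositionalEquality using (refl)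

  k5⁻sym : ∀ u v → k5⁻adj u v ≡ k5⁻adj v u
  k5⁻sym fzero fzero = refl
  k5⁻sym fzero (fsuc fzero) = refl
  k5⁻sym fzero (fsuc (fsuc _)) = refl
  k5⁻sym (fsuc fzero) fzero = refl
  k5⁻sym (fsuc fzero) (fsuc fzero) = refl
  k5⁻sym (fsuc fzero) (fsuc (fsuc _)) = refl
  k5⁻sym (fsuc (fsuc _)) fzero = refl
  k5⁻sym (fsuc (fsuc _)) (fsuc fzero) = refl
  k5⁻sym (fsuc (fsuc i)) (fsuc (fsuc j)) with i ≟ j | j ≟ i
  ... | Relation.Nullary.yes _ | Relation.Nullary.yes _ = refl
  ... | Relation.Nullary.no  _ | Relation.Nullary.no  _ = refl
  ... | Relation.Nullary.yes p | Relation.Nullary.no ¬q = Data.Empty.⊥-elim (¬q (Relation.Binary.PropositionalEquality.sym p))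
    where import Data.Empty
  ... | Relation.Nullary.no ¬p | Relation.Nullary.yes q = Data.Empty.⊥-elim (¬p (Relation.Binary.PropositionalEquality.sym q))
    where import Data.Empty

  k5⁻irr : ∀ u → k5⁻adj u u ≡ false
  k5⁻irr fzero = refl
  k5⁻irr (fsuc fzero) = refl
  k5⁻irr (fsuc (fsuc i)) with i ≟ i
  ... | Relation.Nullary.yes _ = refl
  ... | Relation.Nullary.no ¬p = Data.Empty.⊥-elim (¬p refl)
    where import Data.Empty

K5⁻ : Graph 5
K5⁻ = record { adj = k5⁻adj ; sym = k5⁻sym ; irrefl = k5⁻irr }

-- Hamiltonicity: a cycle through all vertices, i.e. a cyclic ordering
-- σ(0), σ(1), …, σ(m) of all vertices (σ a bijection) with at least 3
-- vertices, consecutive vertices adjacent and σ(m) adjacent to σ(0).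

Hamiltonian : ∀ {n} → Graph n → Set
Hamiltonian {zero}  G = Data.Empty.⊥  where import Data.Empty
Hamiltonian {suc m} G =
  2 ≤ m × Σ (Fin (suc m) ↔ Fin (suc m)) λ σ →
    (∀ (i : Fin m) → Adj G (Inverse.to σ (inject₁ i)) (Inverse.to σ (fsuc i)))
    × Adj G (Inverse.to σ (fromℕ m)) (Inverse.to σ fzero)

Colourable : ∀ {n} → ℕ → Graph n → Set
Colourable {n} k G =
  Σ (Fin n → Fin k) λ c → ∀ u v → Adj G u v → c u ≢ c v

ChromaticNumber : ∀ {n} → Graph n → ℕ → Set
ChromaticNumber G k = Colourable k G × (∀ j → j < k → ¬ Colourable j G)

data Walk {n} (G : Graph n) : Fin n → Fin n → Set where
  here : ∀ {u} → Walk G u u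
  step : ∀ {u v w} → Adj G u v → Walk G v w → Walk G u w

Connected : ∀ {n} → Graph n → Set
Connected {n} G = ∀ (u v : Fin n) → Walk G u v

-- Embeddings on the torus, via rotation systems (Heffter–Edmonds).
--
-- A rotation system assigns to every vertex u a cyclic permutation ρ u of
-- its neighbourhood N(u) (ρ u v = the neighbour following v around u).
-- Darts are ordered pairs (u , v) with u ~ v; the face permutation is
-- φ (u , v) = (v , ρ v u); faces are the orbits of φ.  For a connected
-- graph, the embedding is on the orientable surface of genus g with
-- V − E + F = 2 − 2g.  A connected graph embeds on the torus iff some
-- rotation system has genus ≤ 1, i.e. V − E + F ≥ 0.

allB : ∀ {A : Set} → (A → Bool) → List A → Bool
allB p []       = true
allB p (x ∷ xs) = p x ∧ allB p xs

iter : ∀ {A : Set} → ℕ → (A → A) → A → A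
iter zero    f x = x
iter (suc k) f x = f (iter k f x)

record RotationSystem {n} (G : Graph n) : Set where
  field
    ρ       : Fin n → Fin n → Fin n
    closed  : ∀ u v → Adj G u v → Adj G u (ρ u v)
    -- ρ u acts transitively on N(u); together with `closed` this makes it
    -- a single cyclic permutation of N(u)
    cyclic  : ∀ u v w → Adj G u v → Adj G u w → ∃[ k ] iter k (ρ u) v ≡ w
open RotationSystem public

module _ {n} (G : Graph n) (R : RotationSystem G) where

  Dart : Set
  Dart = Fin n × Fin n

  allPairs : List Dart
  allPairs = cartesianProduct (allFin n) (allFin n)

  isDart : Dart → Bool
  isDart (u , v) = adj G u v

  φ : Dart → Dart
  φ (u , v) = v , ρ R v u

  key : Dart → ℕ
  key (u , v) = toℕ u * n + toℕ v

  -- d is the key-minimal dart of its φ-orbit (orbits have length ≤ n*n)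
  orbitMin : Dart → Bool
  orbitMin d = allB (λ k → key d ≤ᵇ key (iter k φ d)) (upTo (n * n))

  -- number of darts (= 2E)
  #darts : ℕ
  #darts = length (filter (λ d → T? (isDart d)) allPairs)
    where open import Data.Bool.Properties using (T?)

  -- number of faces = number of φ-orbits on darts
  #faces : ℕ
  #faces = length (filter (λ d → T? (isDart d ∧ orbitMin d)) allPairs)
    where open import Data.Bool.Properties using (T?)

-- Connected G embeds on the torus: some rotation system with
-- V − E + F ≥ 0, written 2E ≤ 2(V + F).
EmbedsOnTorus : ∀ {n} → Graph n → Set
EmbedsOnTorus {n} G =
  Connected G × Σ (RotationSystem G) λ R → #darts G R ≤ 2 * (n + #faces G R)

{-# OPTIONS --safe #-}
-- Attach to the circulant graph C₁₃(1, 3, 4) an ear: a path p₀ — ⋯ — pₖ of new vertices with p₀ joined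
-- to 12 and pₖ to 0. C₁₃(1, 3, 4) triangulates the torus, and the ear can be drawn inside the triangle
-- 0, 12, 3. The vertex order 0, 1, …, 12, p₀, …, pₖ is a Hamiltonian cycle. Independent sets of
-- C₁₃(1, 3, 4) have at most 3 of its 13 vertices, so it needs 5 colours, and a 5-colouring extends along
-- the ear with two colours missing at 0 and 12. C₁₃(1, 3, 4) has no K₄ and ear vertices have degree 2,
-- so no graph of the family contains K₄, let alone K₅⁻. Their orders 14 + k are distinct.

module Submission where

open import Defs hiding (sym)
open import Data.Bool using (Bool; true; false; not; _∧_; _∨_; if_then_else_)
import Data.Bool as Bool
open import Data.Bool.Properties using (T?; T-≡)
import Data.Bool.Properties as BoolP
open import Data.Empty using (⊥; ⊥-elim)
open import Data.Fin using (Fin; zero; suc; toℕ; #_; inject₁; inject≤; fromℕ; punchIn; splitAt; join; _↑ˡ_; _↑ʳ_; _≟_)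
open import Data.Fin.Patterns using (0F; 1F; 2F; 3F)
open import Data.Fin.Permutation using (↔⇒≡)
import Data.Fin.Properties as FinP
open import Data.Fin.Relation.Unary.Top using (view; ‵fromℕ; ‵inject₁; view-fromℕ; view-inject₁)
import Data.List as List
open import Data.List using (List; []; _∷_; length; filter; allFin; upTo; cartesianProduct; map; _++_)
open import Data.List.Membership.Propositional using (_∈_)
import Data.List.Membership.Propositional.Properties as ∈P
open import Data.List.Properties using (length-removeAt′; length-tabulate; length-map; length-++)
open import Data.List.Relation.Binary.Subset.Propositional using (_⊆_)
open import Data.List.Relation.Unary.All using (All; []; _∷_)
import Data.List.Relation.Unary.All as All
import Data.List.Relation.Unary.All.Properties as AllP
open import Data.List.Relation.Unary.Any using (here; there; index; _─_)
open import Data.List.Relation.Unary.Unique.Propositional using (Unique; []; _∷_)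
import Data.List.Relation.Unary.Unique.Propositional.Properties as UniqueP
open import Data.Maybe using (Maybe; just; nothing)
import Data.Maybe.Properties as MaybeP
open import Data.Nat using (ℕ; zero; suc; parity; _+_; _*_; _∸_; _%_; _≤_; _<_; _<?_; z≤n; s≤s; s≤s⁻¹; _≤ᵇ_)
open import Data.Nat.DivMod using (_mod_)
import Data.Nat.Properties as ℕP
open import Data.Nat.Tactic.RingSolver using (solve-∀)
open import Data.Parity.Base using (Parity; 0ℙ; 1ℙ; _⁻¹)
import Data.Parity.Properties as ParityP
import Data.Product as Product
open import Data.Product using (Σ; ∃-syntax; Σ-syntax; _×_; _,_; proj₁; proj₂)
import Data.Sum as Sum
open import Data.Sum using (_⊎_; inj₁; inj₂)
import Data.Sum.Properties as SumP
open import Function using (_∘_; _$_; id)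
open import Function.Bundles using (Inverse; Equivalence; mk⇔)
open import Function.Construct.Identity using (↔-id)
open import Relation.Binary.PropositionalEquality
open import Relation.Nullary using (¬_; contradiction; ¬?; Dec; yes; no; does; _×-dec_; _→-dec_)
open import Relation.Nullary.Decidable using (map′; from-yes; dec-true; dec-false; does-⇔)

module _ {A : Set} {P : A → Set} (P? : ∀ x → Dec (P x)) where

  length-filter-∁ : ∀ xs → length (filter P? xs) + length (filter (¬? ∘ P?) xs) ≡ length xs
  length-filter-∁ []       = refl
  length-filter-∁ (x ∷ xs) with does (P? x)
  ... | true  = cong suc (length-filter-∁ xs)
  ... | false = trans (ℕP.+-suc _ _) (cong suc (length-filter-∁ xs))

  length-filter-filter : ∀ {Q : A → Set} (Q? : ∀ x → Dec (Q x)) xs →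
                         length (filter P? (filter Q? xs)) ≤ length (filter P? xs)
  length-filter-filter Q? []       = z≤n
  length-filter-filter Q? (x ∷ xs) with does (Q? x)
  ... | true with does (P? x)
  ...   | true  = s≤s (length-filter-filter Q? xs)
  ...   | false = length-filter-filter Q? xs
  length-filter-filter Q? (x ∷ xs) | false with does (P? x)
  ...   | true  = ℕP.m≤n⇒m≤1+n (length-filter-filter Q? xs)
  ...   | false = length-filter-filter Q? xs

∈-─ : ∀ {A : Set} {x y : A} {ys} (x∈ys : x ∈ ys) → y ∈ ys → y ≢ x → y ∈ (ys ─ x∈ys)
∈-─ (here refl)  (here refl)  y≢x = ⊥-elim (y≢x refl)
∈-─ (here refl)  (there y∈ys) _   = y∈ys
∈-─ (there _)    (here refl)  _   = here refl
∈-─ (there x∈ys) (there y∈ys) y≢x = there (∈-─ x∈ys y∈ys y≢x)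

unique⇒length≤ : ∀ {A : Set} {xs ys : List A} → Unique xs → xs ⊆ ys → length xs ≤ length ys
unique⇒length≤ {xs = []}          _                  _     = z≤n
unique⇒length≤ {xs = x ∷ xs} {ys} (x∉xs ∷ xs-unique) xs⊆ys = begin
  suc (length xs)          ≤⟨ s≤s (unique⇒length≤ xs-unique xs⊆ys─x) ⟩
  suc (length (ys ─ x∈ys)) ≡⟨ length-removeAt′ ys (index x∈ys) ⟨
  length ys                ∎
  where
  open ℕP.≤-Reasoning
  x∈ys : x ∈ ys
  x∈ys = xs⊆ys (here refl)
  xs⊆ys─x : xs ⊆ (ys ─ x∈ys)
  xs⊆ys─x y∈xs = ∈-─ x∈ys (xs⊆ys (there y∈xs)) (λ { refl → All.lookup x∉xs y∈xs refl })

witness : ∀ {A : Set} (a? : Dec A) → does a? ≡ true → A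
witness (yes a) _ = a

∧-true : ∀ a {b} → a ∧ b ≡ true → a ≡ true × b ≡ true
∧-true true a∧b = refl , a∧b

iter-conjugate : ∀ {A B : Set} (f : A → A) (g : B → B) (h : A → B) →
                 (∀ a → g (h a) ≡ h (f a)) → ∀ r a → iter r g (h a) ≡ h (iter r f a)
iter-conjugate f g h commute zero    a = refl
iter-conjugate f g h commute (suc r) a =
  trans (cong g (iter-conjugate f g h commute r a)) (commute (iter r f a))

splitAt-fromℕ : ∀ p q → splitAt (suc p) {suc q} (fromℕ (p + suc q)) ≡ inj₂ (fromℕ q)
splitAt-fromℕ zero    q = refl
splitAt-fromℕ (suc p) q rewrite splitAt-fromℕ p q = refl

splitAt-consecutive : ∀ p {q} (i : Fin (p + suc q)) →
    (∃[ x ] splitAt (suc p) (inject₁ i) ≡ inj₁ (inject₁ x) × splitAt (suc p) (suc i) ≡ inj₁ (suc x))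
  ⊎ (splitAt (suc p) (inject₁ i) ≡ inj₁ (fromℕ p) × splitAt (suc p) (suc i) ≡ inj₂ zero)
  ⊎ (∃[ j ] splitAt (suc p) (inject₁ i) ≡ inj₂ (inject₁ j) × splitAt (suc p) (suc i) ≡ inj₂ (suc j))
splitAt-consecutive zero    zero    = inj₂ (inj₁ (refl , refl))
splitAt-consecutive zero    (suc j) = inj₂ (inj₂ (j , refl , refl))
splitAt-consecutive (suc p) zero    = inj₁ (zero , refl , refl)
splitAt-consecutive (suc p) (suc i) with splitAt-consecutive p i
... | inj₁ (x , e₁ , e₂)        = inj₁ (suc x , cong (Sum.map₁ suc) e₁ , cong (Sum.map₁ suc) e₂)
... | inj₂ (inj₁ (e₁ , e₂))     = inj₂ (inj₁ (cong (Sum.map₁ suc) e₁ , cong (Sum.map₁ suc) e₂))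
... | inj₂ (inj₂ (j , e₁ , e₂)) = inj₂ (inj₂ (j , cong (Sum.map₁ suc) e₁ , cong (Sum.map₁ suc) e₂))

maybe-all? : ∀ {n} {P : Maybe (Fin n) → Set} → (∀ o → Dec (P o)) → Dec (∀ o → P o)
maybe-all? P? = map′ (λ (p , q) → λ { nothing → p ; (just y) → q y }) (λ h → h nothing , h ∘ just)
                     (P? nothing ×-dec FinP.all? (P? ∘ just))

module _ {n} {G : Graph n} where

  _++ʷ_ : ∀ {u v w} → Walk G u v → Walk G v w → Walk G u w
  here     ++ʷ q = q
  step e p ++ʷ q = step e (p ++ʷ q)

  reverseʷ : ∀ {u v} → Walk G u v → Walk G v u
  reverseʷ here               = here
  reverseʷ (step {u} {v} e p) = reverseʷ p ++ʷ step (trans (Graph.sym G v u) e) here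

  walk-along : ∀ {m} (f : Fin (suc m) → Fin n) →
               (∀ i → Adj G (f (inject₁ i)) (f (suc i))) → ∀ i → Walk G (f zero) (f i)
  walk-along         f f-path zero    = here
  walk-along {suc m} f f-path (suc i) = step (f-path zero) (walk-along (f ∘ suc) (f-path ∘ suc) i)

hamiltonian⇒connected : ∀ {n} {G : Graph n} → Hamiltonian G → Connected G
hamiltonian⇒connected {suc m} {G} (_ , σ , σ-path , _) u v =
  reverseʷ (from-start u) ++ʷ from-start v
  where
  open Inverse σ
  from-start : ∀ w → Walk G (to zero) w
  from-start w = subst (Walk G (to zero)) (strictlyInverseˡ w) (walk-along to σ-path (from w))

colourable-mono : ∀ {n j k} {G : Graph n} → j ≤ k → Colourable j G → Colourable k G
colourable-mono j≤k (c , proper) =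
  (λ u → inject≤ (c u) j≤k) ,
  λ u v e → proper u v e ∘ FinP.inject≤-injective j≤k j≤k (c u) (c v)

colourable-sub : ∀ {n m k} {G : Graph n} {H : Graph m} →
                 ContainsSubgraph G H → Colourable k G → Colourable k H
colourable-sub (f , _ , f-hom) (c , proper) = c ∘ f , λ u v e → proper (f u) (f v) (f-hom u v e)

chromaticNumber-intro : ∀ {n k} {G : Graph n} →
                        Colourable (suc k) G → ¬ Colourable k G → ChromaticNumber G (suc k)
chromaticNumber-intro {G = G} col ¬col = col , λ j j<1+k → ¬col ∘ colourable-mono {G = G} (s≤s⁻¹ j<1+k)

module _ {A : Set} {q} (c : A → Fin q) where

  colourClass : Fin q → List A → List A
  colourClass κ = filter (λ x → c x ≟ κ)

  pigeonhole : ∀ r (cs : List (Fin q)) xs → (∀ {x} → x ∈ xs → c x ∈ cs) →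
               length cs * r < length xs → ∃[ κ ] r < length (colourClass κ xs)
  pigeonhole r []       (x ∷ _) covered _ with () ← covered (here refl)
  pigeonhole r (κ ∷ cs) xs      covered big with r <? length (colourClass κ xs)
  ... | yes r<class = κ , r<class
  ... | no  r≮class =
    let κ′ , r<class′ = pigeonhole r cs rest rest-covered rest-big
    in  κ′ , ℕP.<-≤-trans r<class′ (length-filter-filter (λ x → c x ≟ κ′) (λ x → ¬? (c x ≟ κ)) xs)
    where
    open ℕP.≤-Reasoning
    rest : List A
    rest = filter (λ x → ¬? (c x ≟ κ)) xs
    rest-covered : ∀ {x} → x ∈ rest → c x ∈ cs
    rest-covered x∈rest with ∈P.∈-filter⁻ (λ x → ¬? (c x ≟ κ)) x∈rest
    ... | x∈xs , cx≢κ with covered x∈xs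
    ...   | here cx≡κ    = ⊥-elim (cx≢κ cx≡κ)
    ...   | there cx∈cs = cx∈cs
    rest-big : length cs * r < length rest
    rest-big = ℕP.+-cancelˡ-< r _ _ $ begin-strict
      r + length cs * r                            <⟨ big ⟩
      length xs                                    ≡⟨ length-filter-∁ (λ x → c x ≟ κ) xs ⟨
      length (colourClass κ xs) + length rest      ≤⟨ ℕP.+-monoˡ-≤ _ (ℕP.≮⇒≥ r≮class) ⟩
      r + length rest                              ∎

Independent : ∀ {n} → Graph n → List (Fin n) → Set
Independent G xs = Unique xs × (∀ {u v} → u ∈ xs → v ∈ xs → adj G u v ≡ false)

colourClass-independent : ∀ {n q} (G : Graph n) ((c , _) : Colourable q G) κ →
                          Independent G (colourClass c κ (allFin n))
colourClass-independent {n} G (c , proper) κ =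
  UniqueP.filter⁺ (λ x → c x ≟ κ) (UniqueP.allFin⁺ n) , non-adjacent
  where
  non-adjacent : ∀ {u v} → u ∈ colourClass c κ (allFin n) → v ∈ colourClass c κ (allFin n) →
                 adj G u v ≡ false
  non-adjacent {u} {v} u∈class v∈class with adj G u v in u~v
  ... | false = refl
  ... | true  = ⊥-elim (proper u v u~v (trans (coloured-κ u∈class) (sym (coloured-κ v∈class))))
    where
    coloured-κ : ∀ {w} → w ∈ colourClass c κ (allFin n) → c w ≡ κ
    coloured-κ = proj₂ ∘ ∈P.∈-filter⁻ (λ x → c x ≟ κ) {xs = allFin n}

¬colourable-by-independence : ∀ {n q α} (G : Graph n) → (∀ xs → Independent G xs → length xs ≤ α) →
                              q * α < n → ¬ Colourable q G
¬colourable-by-independence {n} {q} {α} G α-bound q*α<n col@(c , _) =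
  let κ , α<class = pigeonhole c α (allFin q) (allFin n) (λ _ → ∈P.∈-allFin _) sizes
  in  ℕP.<⇒≱ α<class (α-bound _ (colourClass-independent G col κ))
  where
  sizes : length (allFin q) * α < length (allFin n)
  sizes rewrite length-tabulate {n = q} id | length-tabulate {n = n} id = q*α<n

containsSubgraph-trans : ∀ {n m l} {G : Graph n} {H : Graph m} {K : Graph l} →
                         ContainsSubgraph G H → ContainsSubgraph H K → ContainsSubgraph G K
containsSubgraph-trans (f , f-inj , f-hom) (g , g-inj , g-hom) =
  f ∘ g , g-inj ∘ f-inj , λ u v e → f-hom (g u) (g v) (g-hom u v e)

complete : ∀ n → Graph n
complete n = record
  { adj    = λ u v → not (does (u ≟ v))
  ; sym    = λ u v → cong not (does-⇔ (mk⇔ sym sym) (u ≟ v) (v ≟ u))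
  ; irrefl = λ u → cong not (dec-true (u ≟ u) refl)
  }

K₄-free⇒K₅⁻-free : ∀ {n} (G : Graph n) → ¬ ContainsSubgraph G (complete 4) → ¬ ContainsSubgraph G K5⁻
K₄-free⇒K₅⁻-free G K₄-free G⊇K₅⁻ =
  K₄-free (containsSubgraph-trans {G = G} {H = K5⁻} {K = complete 4} G⊇K₅⁻ K₅⁻-contains-K₄)
  where
  K₅⁻-contains-K₄ : ContainsSubgraph K5⁻ (complete 4)
  K₅⁻-contains-K₄ = punchIn 1F , FinP.punchIn-injective 1F _ _ ,
    from-yes (FinP.all? λ u → FinP.all? λ v →
      (adj (complete 4) u v Bool.≟ true) →-dec (adj K5⁻ (punchIn 1F u) (punchIn 1F v) Bool.≟ true))

darts : ∀ {n} → Graph n → List (Fin n × Fin n)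
darts {n} G = filter (λ d → T? (adj G (proj₁ d) (proj₂ d))) (cartesianProduct (allFin n) (allFin n))

module _ {n} {G : Graph n} (R : RotationSystem G) where

  FaceRepresentative : Dart G R → Set
  FaceRepresentative d = isDart G R d ≡ true × orbitMin G R d ≡ true

  orbitMin-intro : ∀ (Q : Dart G R → Set) {d} → Q d → (∀ {x} → Q x → Q (φ G R x)) →
                   (∀ {x} → Q x → key G R d ≤ key G R x) → orbitMin G R d ≡ true
  orbitMin-intro Q {d} Q-d Q-closed d-minimal = allB-true (upTo (n * n))
    where
    Q-orbit : ∀ r → Q (iter r (φ G R) d)
    Q-orbit zero    = Q-d
    Q-orbit (suc r) = Q-closed (Q-orbit r)
    allB-true : ∀ rs → allB (λ r → key G R d ≤ᵇ key G R (iter r (φ G R) d)) rs ≡ true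
    allB-true []       = refl
    allB-true (r ∷ rs) rewrite Equivalence.to T-≡ (ℕP.≤⇒≤ᵇ (d-minimal (Q-orbit r))) = allB-true rs

  key-< : ∀ d d′ → toℕ (proj₁ d) < toℕ (proj₁ d′) → key G R d ≤ key G R d′
  key-< (u , v) (u′ , v′) u<u′ = begin
    toℕ u * n + toℕ v     ≤⟨ ℕP.+-monoʳ-≤ (toℕ u * n) (ℕP.<⇒≤ (FinP.toℕ<n v)) ⟩
    toℕ u * n + n         ≡⟨ ℕP.+-comm (toℕ u * n) n ⟩
    suc (toℕ u) * n       ≤⟨ ℕP.*-monoˡ-≤ n u<u′ ⟩
    toℕ u′ * n            ≤⟨ ℕP.m≤m+n (toℕ u′ * n) (toℕ v′) ⟩
    toℕ u′ * n + toℕ v′   ∎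
    where open ℕP.≤-Reasoning

  length≤#faces : ∀ ds → Unique ds → All FaceRepresentative ds → length ds ≤ #faces G R
  length≤#faces ds ds-unique ds-faces = unique⇒length≤ ds-unique λ d∈ds →
    let d-dart , d-min = All.lookup ds-faces d∈ds
    in  ∈P.∈-filter⁺ (λ d → T? (isDart G R d ∧ orbitMin G R d))
          (∈P.∈-cartesianProduct⁺ (∈P.∈-allFin _) (∈P.∈-allFin _))
          (Equivalence.from T-≡ (cong₂ _∧_ d-dart d-min))

  #darts≤length : ∀ ds → (∀ {u v} → Adj G u v → (u , v) ∈ ds) → #darts G R ≤ length ds
  #darts≤length ds darts⊆ds = unique⇒length≤
    (UniqueP.filter⁺ (λ d → T? (isDart G R d))
      (UniqueP.cartesianProduct⁺ (UniqueP.allFin⁺ n) (UniqueP.allFin⁺ n)))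
    λ d∈darts → darts⊆ds (Equivalence.to T-≡
      (proj₂ (∈P.∈-filter⁻ (λ d → T? (isDart G R d)) {xs = allPairs G R} d∈darts)))

-- Attaching an ear

-- H together with a stub: one new vertex, `nothing`, joined to zero and last.
module Stub {m} (H : Graph (2 + m)) where

  last : Fin (2 + m)
  last = fromℕ (suc m)

  adj⁺ : Fin (2 + m) → Maybe (Fin (2 + m)) → Bool
  adj⁺ x       (just y) = adj H x y
  adj⁺ zero    nothing  = true
  adj⁺ (suc x) nothing  = does (suc x ≟ last)

  record Rotation : Set where
    field
      rot        : Fin (2 + m) → Maybe (Fin (2 + m)) → Maybe (Fin (2 + m))
      rot-closed : ∀ x o → adj⁺ x o ≡ true → adj⁺ x (rot x o) ≡ true
      rot-cyclic : ∀ x o o′ → adj⁺ x o ≡ true → adj⁺ x o′ ≡ true → ∃[ r ] iter r (rot x) o ≡ o′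

  module _ (ρ⁺ : Rotation) where
    open Rotation ρ⁺

    TriangleRep : Fin (2 + m) × Fin (2 + m) → Set
    TriangleRep (x , y) = ∃[ z ] adj H x y ≡ true
      × rot y (just x) ≡ just z × rot z (just y) ≡ just x × rot x (just z) ≡ just y
      × toℕ x < toℕ y × toℕ x < toℕ z

    triangleRep? : ∀ d → Dec (TriangleRep d)
    triangleRep? (x , y) = FinP.any? λ z → (adj H x y Bool.≟ true)
      ×-dec (rot y (just x) ≟ₘ just z) ×-dec (rot z (just y) ≟ₘ just x) ×-dec (rot x (just z) ≟ₘ just y)
      ×-dec (toℕ x <? toℕ y) ×-dec (toℕ x <? toℕ z)
      where
      _≟ₘ_ : (o o′ : Maybe (Fin (2 + m))) → Dec (o ≡ o′)
      _≟ₘ_ = MaybeP.≡-dec _≟_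

    triangleReps : List (Fin (2 + m) × Fin (2 + m))
    triangleReps = filter triangleRep? (cartesianProduct (allFin (2 + m)) (allFin (2 + m)))

    -- The ear is to be drawn inside the face zero → last → c of H, whose darts the stub replaces.
    record InsideFace (c : Fin (2 + m)) : Set where
      field
        rot-last-zero : rot last (just zero) ≡ nothing
        rot-zero-stub : rot zero nothing ≡ just last
        rot-last-stub : rot last nothing ≡ just c
        rot-c-last    : rot c (just last) ≡ just zero
        rot-zero-c    : rot zero (just c) ≡ nothing
        c≢zero        : c ≢ zero

-- H together with the ear last — p₀ — p₁ — ⋯ — pₖ — zero, where pⱼ is inj₂ j.
module Ear {m} (H : Graph (2 + m)) (k : ℕ) where
  open Stub H

  V : Set
  V = Fin (2 + m) ⊎ Fin (suc k)

  _≟ᵛ_ : (s t : V) → Dec (s ≡ t)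
  _≟ᵛ_ = SumP.≡-dec _≟_ _≟_

  next : Fin (suc k) → V
  next j with view j
  ... | ‵fromℕ     = inj₁ zero
  ... | ‵inject₁ i = inj₂ (suc i)

  prev : Fin (suc k) → V
  prev zero    = inj₁ last
  prev (suc i) = inj₂ (inject₁ i)

  next-fromℕ : next (fromℕ k) ≡ inj₁ zero
  next-fromℕ rewrite view-fromℕ k = refl

  next-inject₁ : ∀ i → next (inject₁ i) ≡ inj₂ (suc i)
  next-inject₁ i rewrite view-inject₁ i = refl

  next-cases : ∀ j → (j ≡ fromℕ k × next j ≡ inj₁ zero) ⊎ (∃[ i ] j ≡ inject₁ i × next j ≡ inj₂ (suc i))
  next-cases j with view j
  ... | ‵fromℕ     = inj₁ (refl , refl)
  ... | ‵inject₁ i = inj₂ (i , refl , refl)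

  prev≢next : ∀ j → prev j ≢ next j
  prev≢next j eq with next-cases j
  prev≢next zero    eq | inj₁ (_ , next≡) with () ← trans eq next≡
  prev≢next (suc i) eq | inj₁ (_ , next≡) with () ← trans eq next≡
  prev≢next zero    eq | inj₂ (_ , _ , next≡) with () ← trans eq next≡
  prev≢next (suc i) eq | inj₂ (i′ , si≡i′ , next≡) = ℕP.m≢1+n+m (toℕ i′) {1} (begin
    toℕ i′                ≡⟨ FinP.toℕ-inject₁ i′ ⟨
    toℕ (inject₁ i′)      ≡⟨ cong toℕ si≡i′ ⟨
    suc (toℕ i)           ≡⟨ cong suc (FinP.toℕ-inject₁ i) ⟨
    suc (toℕ (inject₁ i)) ≡⟨ cong (suc ∘ toℕ) (SumP.inj₂-injective (trans eq next≡)) ⟩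
    suc (toℕ (suc i′))    ∎)
    where open ≡-Reasoning

  inj₂≢next : ∀ j → inj₂ j ≢ next j
  inj₂≢next j eq with next-cases j
  ... | inj₁ (_ , next≡)          with () ← trans eq next≡
  ... | inj₂ (i , refl , next≡) =
    ℕP.1+n≢n (sym (trans (sym (FinP.toℕ-inject₁ i)) (cong toℕ (SumP.inj₂-injective (trans eq next≡)))))

  -- t follows s on the chain last → p₀ → ⋯ → pₖ → zero.
  link : V → V → Bool
  link (inj₁ x) t = does (x ≟ last) ∧ does (t ≟ᵛ inj₂ zero)
  link (inj₂ j) t = does (t ≟ᵛ next j)

  adjᵛ : V → V → Bool
  adjᵛ (inj₁ x) (inj₁ y) = adj H x y
  adjᵛ s        t        = link s t ∨ link t s

  adjᵛ-sym : ∀ s t → adjᵛ s t ≡ adjᵛ t s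
  adjᵛ-sym (inj₁ x) (inj₁ y) = Graph.sym H x y
  adjᵛ-sym (inj₁ x) (inj₂ j) = BoolP.∨-comm (link (inj₁ x) (inj₂ j)) _
  adjᵛ-sym (inj₂ j) (inj₁ x) = BoolP.∨-comm (link (inj₂ j) (inj₁ x)) _
  adjᵛ-sym (inj₂ j) (inj₂ i) = BoolP.∨-comm (link (inj₂ j) (inj₂ i)) _

  adjᵛ-irrefl : ∀ s → adjᵛ s s ≡ false
  adjᵛ-irrefl (inj₁ x) = Graph.irrefl H x
  adjᵛ-irrefl (inj₂ j) rewrite dec-false (inj₂ j ≟ᵛ next j) (inj₂≢next j) = refl

  link⇒adjᵛ : ∀ s t → link s t ≡ true → adjᵛ s t ≡ true
  link⇒adjᵛ (inj₁ x) (inj₁ y) s→t = contradiction (trans (sym (BoolP.∧-zeroʳ _)) s→t) λ ()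
  link⇒adjᵛ (inj₁ x) (inj₂ j) s→t rewrite s→t = refl
  link⇒adjᵛ (inj₂ j) t        s→t rewrite s→t = refl

  link⇒adjᵛ′ : ∀ s t → link t s ≡ true → adjᵛ s t ≡ true
  link⇒adjᵛ′ s t t→s = trans (adjᵛ-sym s t) (link⇒adjᵛ t s t→s)

  link-next : ∀ j → link (inj₂ j) (next j) ≡ true
  link-next j = dec-true (next j ≟ᵛ next j) refl

  link-prev : ∀ j → link (prev j) (inj₂ j) ≡ true
  link-prev zero    rewrite dec-true (last ≟ last) refl = refl
  link-prev (suc i) = subst (λ t → link (inj₂ (inject₁ i)) t ≡ true) (next-inject₁ i) (link-next (inject₁ i))

  link-end : link (inj₂ (fromℕ k)) (inj₁ zero) ≡ true
  link-end = subst (λ t → link (inj₂ (fromℕ k)) t ≡ true) next-fromℕ (link-next (fromℕ k))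

  link-from : ∀ {j t} → link (inj₂ j) t ≡ true → t ≡ next j
  link-from {j} {t} = witness (t ≟ᵛ next j)

  link-to : ∀ s {j} → link s (inj₂ j) ≡ true → s ≡ prev j
  link-to (inj₁ x) {j} x→j with ∧-true (does (x ≟ last)) x→j
  ... | x≡last , j≡zero with witness (x ≟ last) x≡last | witness (inj₂ j ≟ᵛ inj₂ zero) j≡zero
  ...   | refl | refl = refl
  link-to (inj₂ i) {j} i→j with next-cases i
  ... | inj₁ (_ , next≡) with () ← trans (link-from {i} {inj₂ j} i→j) next≡
  ... | inj₂ (i′ , refl , next≡) with trans (link-from {inject₁ i′} {inj₂ j} i→j) next≡
  ...   | refl = refl

  path-neighbours : ∀ j t → adjᵛ (inj₂ j) t ≡ true → t ≡ prev j ⊎ t ≡ next j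
  path-neighbours j t j~t with link (inj₂ j) t in j→t
  ... | true  = inj₂ (link-from {j} {t} j→t)
  ... | false = inj₁ (link-to t j~t)

  path-degree≤2 : ∀ j {t₁ t₂ t₃} →
                  adjᵛ (inj₂ j) t₁ ≡ true → adjᵛ (inj₂ j) t₂ ≡ true → adjᵛ (inj₂ j) t₃ ≡ true →
                  t₁ ≢ t₂ → t₁ ≢ t₃ → t₂ ≢ t₃ → ⊥
  path-degree≤2 j {t₁} {t₂} {t₃} j~t₁ j~t₂ j~t₃ t₁≢t₂ t₁≢t₃ t₂≢t₃
    with path-neighbours j t₁ j~t₁ | path-neighbours j t₂ j~t₂ | path-neighbours j t₃ j~t₃
  ... | inj₁ e₁ | inj₁ e₂ | _       = t₁≢t₂ (trans e₁ (sym e₂))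
  ... | inj₂ e₁ | inj₂ e₂ | _       = t₁≢t₂ (trans e₁ (sym e₂))
  ... | inj₁ e₁ | _       | inj₁ e₃ = t₁≢t₃ (trans e₁ (sym e₃))
  ... | inj₂ e₁ | _       | inj₂ e₃ = t₁≢t₃ (trans e₁ (sym e₃))
  ... | _       | inj₁ e₂ | inj₁ e₃ = t₂≢t₃ (trans e₂ (sym e₃))
  ... | _       | inj₂ e₂ | inj₂ e₃ = t₂≢t₃ (trans e₂ (sym e₃))

  split : Fin (2 + m + suc k) → V
  split = splitAt (2 + m)

  ⟦_⟧ : V → Fin (2 + m + suc k)
  ⟦_⟧ = join (2 + m) (suc k)

  split-⟦⟧ : ∀ s → split ⟦ s ⟧ ≡ s
  split-⟦⟧ = FinP.splitAt-join (2 + m) (suc k)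

  ⟦⟧-split : ∀ u → ⟦ split u ⟧ ≡ u
  ⟦⟧-split = FinP.join-splitAt (2 + m) (suc k)

  ⟦⟧-injective : ∀ {s t} → ⟦ s ⟧ ≡ ⟦ t ⟧ → s ≡ t
  ⟦⟧-injective {s} {t} eq = trans (sym (split-⟦⟧ s)) (trans (cong split eq) (split-⟦⟧ t))

  split-injective : ∀ {u v} → split u ≡ split v → u ≡ v
  split-injective {u} {v} eq = trans (sym (⟦⟧-split u)) (trans (cong ⟦_⟧ eq) (⟦⟧-split v))

  graph : Graph (2 + m + suc k)
  graph = record
    { adj    = λ u v → adjᵛ (split u) (split v)
    ; sym    = λ u v → adjᵛ-sym (split u) (split v)
    ; irrefl = λ u → adjᵛ-irrefl (split u)
    }

  adj-⟦⟧ : ∀ s t → adj graph ⟦ s ⟧ ⟦ t ⟧ ≡ adjᵛ s t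
  adj-⟦⟧ s t = cong₂ adjᵛ (split-⟦⟧ s) (split-⟦⟧ t)

  hamiltonian : (∀ i → Adj H (inject₁ i) (suc i)) → Hamiltonian graph
  hamiltonian H-path = 2≤ , ↔-id _ , consecutive , closing
    where
    2≤ : 2 ≤ suc (m + suc k)
    2≤ = s≤s (ℕP.≤-trans (s≤s z≤n) (ℕP.m≤n+m (suc k) m))
    consecutive : ∀ i → Adj graph (inject₁ i) (suc i)
    consecutive i with splitAt-consecutive (suc m) i
    ... | inj₁ (x , e₁ , e₂)        rewrite e₁ | e₂ = H-path x
    ... | inj₂ (inj₁ (e₁ , e₂))     rewrite e₁ | e₂ = link⇒adjᵛ (inj₁ last) (inj₂ zero) (link-prev zero)
    ... | inj₂ (inj₂ (j , e₁ , e₂)) rewrite e₁ | e₂ =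
      link⇒adjᵛ (inj₂ (inject₁ j)) (inj₂ (suc j)) (link-prev (suc j))
    closing : Adj graph (fromℕ (suc (m + suc k))) zero
    closing rewrite splitAt-fromℕ (suc m) k = link⇒adjᵛ (inj₂ (fromℕ k)) (inj₁ zero) link-end

  contains-H : ContainsSubgraph graph H
  contains-H = (_↑ˡ suc k) , FinP.↑ˡ-injective (suc k) _ _ , λ x y x~y →
    trans (adj-⟦⟧ (inj₁ x) (inj₁ y)) x~y

  colourable : ∀ {r} ((c , _) : Colourable r H) (a b : Fin r) → a ≢ b →
               All (λ κ → κ ≢ a × κ ≢ b) (c zero ∷ c last ∷ []) → Colourable r graph
  colourable {r} (c , proper) a b a≢b ((zero≢a , zero≢b) ∷ (last≢a , _) ∷ []) =
    colourᵛ ∘ split , λ u v → properᵛ (split u) (split v)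
    where
    alternate : Parity → Fin r
    alternate 0ℙ = a
    alternate 1ℙ = b

    alternate-suc : ∀ n → alternate (parity n) ≢ alternate (parity (suc n))
    alternate-suc n rewrite sym (ParityP.suc-homo-⁻¹ n) with parity (suc n)
    ... | 0ℙ = a≢b ∘ sym
    ... | 1ℙ = a≢b

    alternate≢zero : ∀ p → alternate p ≢ c zero
    alternate≢zero 0ℙ = zero≢a ∘ sym
    alternate≢zero 1ℙ = zero≢b ∘ sym

    colourᵛ : V → Fin r
    colourᵛ (inj₁ x) = c x
    colourᵛ (inj₂ j) = alternate (parity (toℕ j))

    link-proper : ∀ s t → link s t ≡ true → colourᵛ s ≢ colourᵛ t
    link-proper (inj₁ x) t x→t with ∧-true (does (x ≟ last)) x→t
    ... | x≡last , t≡p₀ with witness (x ≟ last) x≡last | witness (t ≟ᵛ inj₂ zero) t≡p₀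
    ...   | refl | refl = last≢a
    link-proper (inj₂ j) t j→t with link-from {j} {t} j→t | next-cases j
    ... | refl | inj₁ (_ , next≡) =
      subst (λ t → colourᵛ (inj₂ j) ≢ colourᵛ t) (sym next≡) (alternate≢zero (parity (toℕ j)))
    ... | refl | inj₂ (i , refl , next≡) =
      subst (λ t → colourᵛ (inj₂ (inject₁ i)) ≢ colourᵛ t) (sym next≡)
        (subst (λ n → alternate (parity n) ≢ alternate (parity (suc (toℕ i)))) (sym (FinP.toℕ-inject₁ i))
          (alternate-suc (toℕ i)))

    links-proper : ∀ s t → link s t ∨ link t s ≡ true → colourᵛ s ≢ colourᵛ t
    links-proper s t s~t with link s t in s→t
    ... | true  = link-proper s t s→t
    ... | false = link-proper t s s~t ∘ sym

    properᵛ : ∀ s t → adjᵛ s t ≡ true → colourᵛ s ≢ colourᵛ t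
    properᵛ (inj₁ x) (inj₁ y) = proper x y
    properᵛ (inj₁ x) (inj₂ j) = links-proper (inj₁ x) (inj₂ j)
    properᵛ (inj₂ j) t        = links-proper (inj₂ j) t

  -- Every vertex of a K₄ has three neighbours, which ear vertices lack.
  K₄-free : ¬ ContainsSubgraph H (complete 4) → ¬ ContainsSubgraph graph (complete 4)
  K₄-free H-K₄-free (f , f-inj , f-hom) = H-K₄-free (g , g-inj , g-hom)
    where
    distinct-adjacent : ∀ {i j} → i ≢ j → Adj (complete 4) i j
    distinct-adjacent {i} {j} i≢j = cong not (dec-false (i ≟ j) i≢j)

    in-H : ∀ i → ∃[ x ] split (f i) ≡ inj₁ x
    in-H i with split (f i) in fi≡
    ... | inj₁ x = x , refl
    ... | inj₂ j = ⊥-elim (path-degree≤2 j (neighbour zero) (neighbour (suc zero)) (neighbour (suc (suc zero)))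
                                           (apart λ ()) (apart λ ()) (apart λ ()))
      where
      neighbour : ∀ l → adjᵛ (inj₂ j) (split (f (punchIn i l))) ≡ true
      neighbour l = subst (λ s → adjᵛ s (split (f (punchIn i l))) ≡ true) fi≡
                          (f-hom i (punchIn i l) (distinct-adjacent (FinP.punchInᵢ≢i i l ∘ sym)))
      apart : ∀ {l l′} → l ≢ l′ → split (f (punchIn i l)) ≢ split (f (punchIn i l′))
      apart l≢l′ = l≢l′ ∘ FinP.punchIn-injective i _ _ ∘ f-inj ∘ split-injective

    g : Fin 4 → Fin (2 + m)
    g i = proj₁ (in-H i)

    g-inj : ∀ {i i′} → g i ≡ g i′ → i ≡ i′
    g-inj {i} {i′} eq = f-inj (split-injective (trans (proj₂ (in-H i)) (trans (cong inj₁ eq) (sym (proj₂ (in-H i′))))))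

    g-hom : ∀ u v → Adj (complete 4) u v → Adj H (g u) (g v)
    g-hom u v u~v = subst₂ (λ s t → adjᵛ s t ≡ true) (proj₂ (in-H u)) (proj₂ (in-H v)) (f-hom u v u~v)

  module _ (ρ⁺ : Rotation) where
    open Rotation ρ⁺

    stub : V → Maybe (Fin (2 + m))
    stub (inj₁ y) = just y
    stub (inj₂ _) = nothing

    -- Reading the stub at an end of the ear as the ear vertex next to that end.
    unstub : Fin (2 + m) → Maybe (Fin (2 + m)) → V
    unstub x       (just y) = inj₁ y
    unstub zero    nothing  = inj₂ (fromℕ k)
    unstub (suc x) nothing  = inj₂ zero

    stub-unstub : ∀ x o → stub (unstub x o) ≡ o
    stub-unstub x       (just y) = refl
    stub-unstub zero    nothing  = refl
    stub-unstub (suc x) nothing  = refl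

    neighbour-stub : ∀ x t → adjᵛ (inj₁ x) t ≡ true → adj⁺ x (stub t) ≡ true × unstub x (stub t) ≡ t
    neighbour-stub x (inj₁ y) x~y = x~y , refl
    neighbour-stub x (inj₂ j) x~j with link (inj₁ x) (inj₂ j) in x→j
    ... | true with ∧-true (does (x ≟ last)) x→j
    ...   | x≡last , j≡p₀ with witness (x ≟ last) x≡last | witness (inj₂ j ≟ᵛ inj₂ zero) j≡p₀
    ...     | refl | refl = dec-true (last ≟ last) refl , refl
    neighbour-stub x (inj₂ j) x~j | false with next-cases j | link-from {j} {inj₁ x} x~j
    ... | inj₁ (refl , next≡) | x≡next with trans x≡next next≡
    ...   | refl = refl , refl
    neighbour-stub x (inj₂ j) x~j | false | inj₂ (_ , _ , next≡) | x≡next with () ← trans x≡next next≡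

    unstub-neighbour : ∀ x o → adj⁺ x o ≡ true → adjᵛ (inj₁ x) (unstub x o) ≡ true
    unstub-neighbour x       (just y) x~y = x~y
    unstub-neighbour zero    nothing  _   = link⇒adjᵛ′ (inj₁ zero) (inj₂ (fromℕ k)) link-end
    unstub-neighbour (suc x) nothing  x~o with witness (suc x ≟ last) x~o
    ... | refl = link⇒adjᵛ (inj₁ last) (inj₂ zero) (link-prev zero)

    ρᵛ : V → V → V
    ρᵛ (inj₁ x) t = unstub x (rot x (stub t))
    ρᵛ (inj₂ j) t = if does (t ≟ᵛ prev j) then next j else prev j

    ρᵛ-prev : ∀ j → ρᵛ (inj₂ j) (prev j) ≡ next j
    ρᵛ-prev j rewrite dec-true (prev j ≟ᵛ prev j) refl = refl

    ρᵛ-next : ∀ j → ρᵛ (inj₂ j) (next j) ≡ prev j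
    ρᵛ-next j rewrite dec-false (next j ≟ᵛ prev j) (prev≢next j ∘ sym) = refl

    ρᵛ-closed : ∀ s t → adjᵛ s t ≡ true → adjᵛ s (ρᵛ s t) ≡ true
    ρᵛ-closed (inj₁ x) t x~t = unstub-neighbour x (rot x (stub t)) (rot-closed x (stub t) (proj₁ (neighbour-stub x t x~t)))
    ρᵛ-closed (inj₂ j) t j~t with path-neighbours j t j~t
    ... | inj₁ refl rewrite ρᵛ-prev j = link⇒adjᵛ (inj₂ j) (next j) (link-next j)
    ... | inj₂ refl rewrite ρᵛ-next j = link⇒adjᵛ′ (inj₂ j) (prev j) (link-prev j)

    ρᵛ-cyclic : ∀ s t w → adjᵛ s t ≡ true → adjᵛ s w ≡ true → ∃[ r ] iter r (ρᵛ s) t ≡ w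
    ρᵛ-cyclic (inj₁ x) t w x~t x~w =
      let x~⁺t , t≡ = neighbour-stub x t x~t
          x~⁺w , w≡ = neighbour-stub x w x~w
          r , t↦w   = rot-cyclic x (stub t) (stub w) x~⁺t x~⁺w
      in  r , (begin
        iter r (ρᵛ (inj₁ x)) t                   ≡⟨ cong (iter r (ρᵛ (inj₁ x))) t≡ ⟨
        iter r (ρᵛ (inj₁ x)) (unstub x (stub t)) ≡⟨ iter-conjugate (rot x) (ρᵛ (inj₁ x)) (unstub x)
                                                      (λ o → cong (unstub x ∘ rot x) (stub-unstub x o)) r (stub t) ⟩
        unstub x (iter r (rot x) (stub t))       ≡⟨ cong (unstub x) t↦w ⟩
        unstub x (stub w)                        ≡⟨ w≡ ⟩
        w                                        ∎)
      where open ≡-Reasoning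
    ρᵛ-cyclic (inj₂ j) t w j~t j~w with path-neighbours j t j~t | path-neighbours j w j~w
    ... | inj₁ refl | inj₁ refl = 0 , refl
    ... | inj₂ refl | inj₂ refl = 0 , refl
    ... | inj₁ refl | inj₂ refl = 1 , ρᵛ-prev j
    ... | inj₂ refl | inj₁ refl = 1 , ρᵛ-next j

    rotationSystem : RotationSystem graph
    rotationSystem = record
      { ρ      = λ u v → ⟦ ρᵛ (split u) (split v) ⟧
      ; closed = λ u v u~v → trans (cong (adjᵛ (split u)) (split-⟦⟧ _)) (ρᵛ-closed (split u) (split v) u~v)
      ; cyclic = λ u v w u~v u~w →
          let r , v↦w = ρᵛ-cyclic (split u) (split v) (split w) u~v u~w
          in  r , (begin
            iter r _ v                                 ≡⟨ cong (iter r _) (⟦⟧-split v) ⟨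
            iter r _ ⟦ split v ⟧                       ≡⟨ iter-conjugate (ρᵛ (split u)) _ ⟦_⟧
                                                            (λ t → cong (⟦_⟧ ∘ ρᵛ (split u)) (split-⟦⟧ t)) r (split v) ⟩
            ⟦ iter r (ρᵛ (split u)) (split v) ⟧        ≡⟨ cong ⟦_⟧ v↦w ⟩
            ⟦ split w ⟧                                ≡⟨ ⟦⟧-split w ⟩
            w                                          ∎)
      }
      where open ≡-Reasoning

    private
      RS : RotationSystem graph
      RS = rotationSystem

    φᵛ : V × V → V × V
    φᵛ (s , t) = t , ρᵛ t s

    ⟦_⟧ᵈ : V × V → Fin (2 + m + suc k) × Fin (2 + m + suc k)
    ⟦ s , t ⟧ᵈ = ⟦ s ⟧ , ⟦ t ⟧

    liftᴴ : Fin (2 + m) × Fin (2 + m) → V × V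
    liftᴴ (x , y) = inj₁ x , inj₁ y

    φ-⟦⟧ : ∀ d → φ graph RS ⟦ d ⟧ᵈ ≡ ⟦ φᵛ d ⟧ᵈ
    φ-⟦⟧ (s , t) rewrite split-⟦⟧ s | split-⟦⟧ t = refl

    orbitMin-⟦⟧ : ∀ (Q : V × V → Set) {d} → Q d → (∀ {x} → Q x → Q (φᵛ x)) →
                  (∀ {x} → Q x → key graph RS ⟦ d ⟧ᵈ ≤ key graph RS ⟦ x ⟧ᵈ) →
                  orbitMin graph RS ⟦ d ⟧ᵈ ≡ true
    orbitMin-⟦⟧ Q {d} Q-d Q-closed d-minimal =
      orbitMin-intro RS (λ e → ∃[ x ] Q x × e ≡ ⟦ x ⟧ᵈ) (d , Q-d , refl)
      (λ { (x , Q-x , refl) → φᵛ x , Q-closed Q-x , φ-⟦⟧ x })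
      (λ { (x , Q-x , refl) → d-minimal Q-x })

    zero-first : ∀ t d → proj₁ d ≢ inj₁ zero → key graph RS ⟦ inj₁ zero , t ⟧ᵈ ≤ key graph RS ⟦ d ⟧ᵈ
    zero-first t (inj₁ zero    , _) s≢zero = ⊥-elim (s≢zero refl)
    zero-first t d@(inj₁ (suc x) , _) _    = key-< RS ⟦ inj₁ zero , t ⟧ᵈ ⟦ d ⟧ᵈ (s≤s z≤n)
    zero-first t d@(inj₂ j , _)       _    = key-< RS ⟦ inj₁ zero , t ⟧ᵈ ⟦ d ⟧ᵈ (s≤s z≤n)

    key-<ᴴ : ∀ {x y} t t′ → toℕ x < toℕ y →
             key graph RS ⟦ inj₁ x , t ⟧ᵈ ≤ key graph RS ⟦ inj₁ y , t′ ⟧ᵈ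
    key-<ᴴ {x} {y} t t′ x<y = key-< RS ⟦ inj₁ x , t ⟧ᵈ ⟦ inj₁ y , t′ ⟧ᵈ
      (subst₂ _<_ (sym (FinP.toℕ-↑ˡ x (suc k))) (sym (FinP.toℕ-↑ˡ y (suc k))) x<y)

    triangle-face : ∀ {d} → TriangleRep ρ⁺ d → FaceRepresentative RS ⟦ liftᴴ d ⟧ᵈ
    triangle-face {x , y} (z , x~y , y:x↦z , z:y↦x , x:z↦y , x<y , x<z) =
      trans (adj-⟦⟧ (inj₁ x) (inj₁ y)) x~y , orbitMin-⟦⟧ Q (inj₁ refl) Q-closed minimal
      where
      Q : V × V → Set
      Q d = d ≡ (inj₁ x , inj₁ y) ⊎ d ≡ (inj₁ y , inj₁ z) ⊎ d ≡ (inj₁ z , inj₁ x)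
      Q-closed : ∀ {d} → Q d → Q (φᵛ d)
      Q-closed (inj₁ refl)        = inj₂ (inj₁ (cong (λ o → inj₁ y , unstub y o) y:x↦z))
      Q-closed (inj₂ (inj₁ refl)) = inj₂ (inj₂ (cong (λ o → inj₁ z , unstub z o) z:y↦x))
      Q-closed (inj₂ (inj₂ refl)) = inj₁ (cong (λ o → inj₁ x , unstub x o) x:z↦y)
      minimal : ∀ {d} → Q d → key graph RS ⟦ inj₁ x , inj₁ y ⟧ᵈ ≤ key graph RS ⟦ d ⟧ᵈ
      minimal (inj₁ refl)        = ℕP.≤-refl
      minimal (inj₂ (inj₁ refl)) = key-<ᴴ (inj₁ y) (inj₁ z) x<y
      minimal (inj₂ (inj₂ refl)) = key-<ᴴ (inj₁ y) (inj₁ x) x<z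

    module _ {c} (inside : InsideFace ρ⁺ c) where
      open InsideFace inside

      -- The face zero → last → p₀ → ⋯ → pₖ → zero.
      ear-face₁ : FaceRepresentative RS ⟦ inj₁ zero , inj₁ last ⟧ᵈ
      ear-face₁ = trans (adj-⟦⟧ (inj₁ zero) (inj₁ last)) zero~last , orbitMin-⟦⟧ Q (inj₁ refl) Q-closed minimal
        where
        open ≡-Reasoning
        zero~last : Adj H zero last
        zero~last = subst (λ o → adj⁺ zero o ≡ true) rot-zero-stub (rot-closed zero nothing refl)
        Q : V × V → Set
        Q d = d ≡ (inj₁ zero , inj₁ last) ⊎ d ≡ (inj₁ last , inj₂ zero) ⊎ ∃[ j ] d ≡ (inj₂ j , next j)
        Q-closed : ∀ {d} → Q d → Q (φᵛ d)
        Q-closed (inj₁ refl)        = inj₂ (inj₁ (cong (λ o → inj₁ last , unstub last o) rot-last-zero))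
        Q-closed (inj₂ (inj₁ refl)) = inj₂ (inj₂ (zero , cong (inj₂ zero ,_) (ρᵛ-prev zero)))
        Q-closed (inj₂ (inj₂ (j , refl))) with next-cases j
        ... | inj₁ (refl , next≡) = inj₁ (begin
          next (fromℕ k) , ρᵛ (next (fromℕ k)) (inj₂ (fromℕ k))
            ≡⟨ cong (λ t → t , ρᵛ t (inj₂ (fromℕ k))) next≡ ⟩
          inj₁ zero , unstub zero (rot zero nothing)
            ≡⟨ cong (λ o → inj₁ zero , unstub zero o) rot-zero-stub ⟩
          inj₁ zero , inj₁ last
            ∎)
        ... | inj₂ (i , refl , next≡) = inj₂ (inj₂ (suc i , (begin
          next (inject₁ i) , ρᵛ (next (inject₁ i)) (inj₂ (inject₁ i))
            ≡⟨ cong (λ t → t , ρᵛ t (inj₂ (inject₁ i))) next≡ ⟩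
          inj₂ (suc i) , ρᵛ (inj₂ (suc i)) (prev (suc i))
            ≡⟨ cong (inj₂ (suc i) ,_) (ρᵛ-prev (suc i)) ⟩
          inj₂ (suc i) , next (suc i)
            ∎)))
        minimal : ∀ {d} → Q d → key graph RS ⟦ inj₁ zero , inj₁ last ⟧ᵈ ≤ key graph RS ⟦ d ⟧ᵈ
        minimal     (inj₁ refl)              = ℕP.≤-refl
        minimal {d} (inj₂ (inj₁ refl))       = zero-first (inj₁ last) d λ ()
        minimal {d} (inj₂ (inj₂ (_ , refl))) = zero-first (inj₁ last) d λ ()

      -- The face zero → pₖ → ⋯ → p₀ → last → c → zero.
      ear-face₂ : FaceRepresentative RS ⟦ inj₁ zero , inj₂ (fromℕ k) ⟧ᵈ
      ear-face₂ = trans (adj-⟦⟧ (inj₁ zero) (inj₂ (fromℕ k))) (unstub-neighbour zero nothing refl) ,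
                  orbitMin-⟦⟧ Q (inj₁ refl) Q-closed minimal
        where
        open ≡-Reasoning
        Q : V × V → Set
        Q d = d ≡ (inj₁ zero , inj₂ (fromℕ k)) ⊎ d ≡ (inj₁ last , inj₁ c) ⊎ d ≡ (inj₁ c , inj₁ zero)
            ⊎ ∃[ j ] d ≡ (inj₂ j , prev j)
        Q-closed : ∀ {d} → Q d → Q (φᵛ d)
        Q-closed (inj₁ refl) = inj₂ (inj₂ (inj₂ (fromℕ k , cong (inj₂ (fromℕ k) ,_) (begin
          ρᵛ (inj₂ (fromℕ k)) (inj₁ zero)       ≡⟨ cong (ρᵛ (inj₂ (fromℕ k))) next-fromℕ ⟨
          ρᵛ (inj₂ (fromℕ k)) (next (fromℕ k))  ≡⟨ ρᵛ-next (fromℕ k) ⟩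
          prev (fromℕ k)                        ∎))))
        Q-closed (inj₂ (inj₁ refl))        = inj₂ (inj₂ (inj₁ (cong (λ o → inj₁ c , unstub c o) rot-c-last)))
        Q-closed (inj₂ (inj₂ (inj₁ refl))) = inj₁ (cong (λ o → inj₁ zero , unstub zero o) rot-zero-c)
        Q-closed (inj₂ (inj₂ (inj₂ (zero , refl)))) =
          inj₂ (inj₁ (cong (λ o → inj₁ last , unstub last o) rot-last-stub))
        Q-closed (inj₂ (inj₂ (inj₂ (suc i , refl)))) =
          inj₂ (inj₂ (inj₂ (inject₁ i , cong (inj₂ (inject₁ i) ,_) (begin
          ρᵛ (inj₂ (inject₁ i)) (inj₂ (suc i))          ≡⟨ cong (ρᵛ (inj₂ (inject₁ i))) (next-inject₁ i) ⟨
          ρᵛ (inj₂ (inject₁ i)) (next (inject₁ i))      ≡⟨ ρᵛ-next (inject₁ i) ⟩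
          prev (inject₁ i)                              ∎))))
        minimal : ∀ {d} → Q d → key graph RS ⟦ inj₁ zero , inj₂ (fromℕ k) ⟧ᵈ ≤ key graph RS ⟦ d ⟧ᵈ
        minimal     (inj₁ refl)                     = ℕP.≤-refl
        minimal {d} (inj₂ (inj₁ refl))              = zero-first (inj₂ (fromℕ k)) d λ ()
        minimal {d} (inj₂ (inj₂ (inj₁ refl)))       = zero-first (inj₂ (fromℕ k)) d (c≢zero ∘ SumP.inj₁-injective)
        minimal {d} (inj₂ (inj₂ (inj₂ (_ , refl)))) = zero-first (inj₂ (fromℕ k)) d λ ()

      links : List (V × V)
      links = (inj₁ last , inj₂ zero) ∷ map (λ j → inj₂ j , next j) (allFin (suc k))

      link∈links : ∀ s t → link s t ≡ true → (s , t) ∈ links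
      link∈links (inj₁ x) t x→t with ∧-true (does (x ≟ last)) x→t
      ... | x≡last , t≡p₀ with witness (x ≟ last) x≡last | witness (t ≟ᵛ inj₂ zero) t≡p₀
      ...   | refl | refl = here refl
      link∈links (inj₂ j) t j→t with link-from {j} {t} j→t
      ... | refl = there (∈P.∈-map⁺ (λ j → inj₂ j , next j) (∈P.∈-allFin j))

      dartsᵛ : List (V × V)
      dartsᵛ = map liftᴴ (darts H) ++ links ++ map Product.swap links

      links∈dartsᵛ : ∀ s t → link s t ∨ link t s ≡ true → (s , t) ∈ dartsᵛ
      links∈dartsᵛ s t s~t with link s t in s→t
      ... | true  = ∈P.∈-++⁺ʳ (map liftᴴ (darts H)) (∈P.∈-++⁺ˡ (link∈links s t s→t))
      ... | false =
        ∈P.∈-++⁺ʳ (map liftᴴ (darts H)) (∈P.∈-++⁺ʳ links (∈P.∈-map⁺ Product.swap (link∈links t s s~t)))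

      adj∈dartsᵛ : ∀ s t → adjᵛ s t ≡ true → (s , t) ∈ dartsᵛ
      adj∈dartsᵛ (inj₁ x) (inj₁ y) x~y = ∈P.∈-++⁺ˡ (∈P.∈-map⁺ liftᴴ
        (∈P.∈-filter⁺ (λ d → T? (adj H (proj₁ d) (proj₂ d)))
          (∈P.∈-cartesianProduct⁺ (∈P.∈-allFin x) (∈P.∈-allFin y)) (Equivalence.from T-≡ x~y)))
      adj∈dartsᵛ (inj₁ x) (inj₂ j) = links∈dartsᵛ (inj₁ x) (inj₂ j)
      adj∈dartsᵛ (inj₂ j) t        = links∈dartsᵛ (inj₂ j) t

      #darts≤ : #darts graph RS ≤ length (darts H) + (2 + k + (2 + k))
      #darts≤ = ℕP.≤-trans
        (#darts≤length RS (map ⟦_⟧ᵈ dartsᵛ) λ {u} {v} u~v →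
          subst (_∈ map ⟦_⟧ᵈ dartsᵛ) (cong₂ _,_ (⟦⟧-split u) (⟦⟧-split v))
                (∈P.∈-map⁺ ⟦_⟧ᵈ (adj∈dartsᵛ (split u) (split v) u~v)))
        (ℕP.≤-reflexive |dartsᵛ|)
        where
        |links| : length links ≡ 2 + k
        |links| = cong suc (trans (length-map _ (allFin (suc k))) (length-tabulate {n = suc k} id))
        |dartsᵛ| : length (map ⟦_⟧ᵈ dartsᵛ) ≡ length (darts H) + (2 + k + (2 + k))
        |dartsᵛ| = begin
          length (map ⟦_⟧ᵈ dartsᵛ)                                        ≡⟨ length-map ⟦_⟧ᵈ dartsᵛ ⟩
          length (map liftᴴ (darts H) ++ links ++ map Product.swap links) ≡⟨ length-++ (map liftᴴ (darts H)) ⟩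
          length (map liftᴴ (darts H)) + length (links ++ map Product.swap links)
            ≡⟨ cong₂ _+_ (length-map liftᴴ (darts H)) (length-++ links) ⟩
          length (darts H) + (length links + length (map Product.swap links))
            ≡⟨ cong (λ l → length (darts H) + (length links + l)) (length-map Product.swap links) ⟩
          length (darts H) + (length links + length links)
            ≡⟨ cong (λ l → length (darts H) + (l + l)) |links| ⟩
          length (darts H) + (2 + k + (2 + k))                            ∎
          where open ≡-Reasoning

      faceRepsᵛ : List (V × V)
      faceRepsᵛ = (inj₁ zero , inj₂ (fromℕ k)) ∷ map liftᴴ ((zero , last) ∷ triangleReps ρ⁺)

      faceRepsᵛ-unique : Unique faceRepsᵛ
      faceRepsᵛ-unique = AllP.map⁺ (All.universal (λ _ ()) _)
                       ∷ UniqueP.map⁺ (λ { refl → refl }) (All.tabulate not-triangle ∷ triangleReps-unique)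
        where
        not-triangle : ∀ {d} → d ∈ triangleReps ρ⁺ → (zero , last) ≢ d
        not-triangle d∈reps refl with proj₂ (∈P.∈-filter⁻ (triangleRep? ρ⁺) d∈reps)
        ... | _ , _ , last:zero↦z , _ with () ← trans (sym rot-last-zero) last:zero↦z
        triangleReps-unique : Unique (triangleReps ρ⁺)
        triangleReps-unique = UniqueP.filter⁺ (triangleRep? ρ⁺)
          (UniqueP.cartesianProduct⁺ (UniqueP.allFin⁺ (2 + m)) (UniqueP.allFin⁺ (2 + m)))

      #faces≥ : 2 + length (triangleReps ρ⁺) ≤ #faces graph RS
      #faces≥ = subst (_≤ #faces graph RS) |reps|
        (length≤#faces RS (map ⟦_⟧ᵈ faceRepsᵛ) (UniqueP.map⁺ ⟦⟧ᵈ-injective faceRepsᵛ-unique) reps-faces)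
        where
        reps-faces : All (FaceRepresentative RS) (map ⟦_⟧ᵈ faceRepsᵛ)
        reps-faces = AllP.map⁺ {xs = faceRepsᵛ} (ear-face₂ ∷
          AllP.map⁺ {xs = (zero , last) ∷ triangleReps ρ⁺} (ear-face₁ ∷ All.tabulate λ {d} d∈reps →
            triangle-face {d} (proj₂ (∈P.∈-filter⁻ (triangleRep? ρ⁺) d∈reps))))
        ⟦⟧ᵈ-injective : ∀ {d d′} → ⟦ d ⟧ᵈ ≡ ⟦ d′ ⟧ᵈ → d ≡ d′
        ⟦⟧ᵈ-injective eq = cong₂ _,_ (⟦⟧-injective (cong proj₁ eq)) (⟦⟧-injective (cong proj₂ eq))
        |reps| : length (map ⟦_⟧ᵈ faceRepsᵛ) ≡ 2 + length (triangleReps ρ⁺)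
        |reps| = trans (length-map ⟦_⟧ᵈ faceRepsᵛ) (cong (2 +_) (length-map liftᴴ (triangleReps ρ⁺)))

      -- V − E + F ≥ 0 for the stub graph; each further ear vertex adds one vertex, one edge and no face.
      euler : length (darts H) ≤ 2 * (2 + m + 1 + length (triangleReps ρ⁺)) →
              #darts graph RS ≤ 2 * (2 + m + suc k + #faces graph RS)
      euler stub-euler = begin
        #darts graph RS                                              ≤⟨ #darts≤ ⟩
        length (darts H) + (2 + k + (2 + k))                         ≤⟨ ℕP.+-monoˡ-≤ _ stub-euler ⟩
        2 * (2 + m + 1 + length (triangleReps ρ⁺)) + (2 + k + (2 + k)) ≡⟨ regroup m k (length (triangleReps ρ⁺)) ⟩
        2 * (2 + m + suc k + (2 + length (triangleReps ρ⁺)))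
          ≤⟨ ℕP.*-monoʳ-≤ 2 (ℕP.+-monoʳ-≤ (2 + m + suc k) #faces≥) ⟩
        2 * (2 + m + suc k + #faces graph RS)                        ∎
        where
        open ℕP.≤-Reasoning
        regroup : ∀ m k t → 2 * (2 + m + 1 + t) + (2 + k + (2 + k)) ≡ 2 * (2 + m + suc k + (2 + t))
        regroup = solve-∀

      embedsOnTorus : (∀ i → Adj H (inject₁ i) (suc i)) →
                      length (darts H) ≤ 2 * (2 + m + 1 + length (triangleReps ρ⁺)) → EmbedsOnTorus graph
      embedsOnTorus H-path stub-euler = hamiltonian⇒connected (hamiltonian H-path) , RS , euler stub-euler

-- The circulant graph C₁₃(1, 3, 4)

_⊖_ : Fin 13 → Fin 13 → ℕ
y ⊖ x = (13 + toℕ y ∸ toℕ x) % 13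

isConnection : ℕ → Bool
isConnection 1  = true
isConnection 3  = true
isConnection 4  = true
isConnection 9  = true
isConnection 10 = true
isConnection 12 = true
isConnection _  = false

adj₁₃ : Fin 13 → Fin 13 → Bool
adj₁₃ x y = isConnection (y ⊖ x)

C₁₃ : Graph 13
C₁₃ = record
  { adj    = adj₁₃
  ; sym    = from-yes (FinP.all? λ x → FinP.all? λ y → adj₁₃ x y Bool.≟ adj₁₃ y x)
  ; irrefl = from-yes (FinP.all? λ x → adj₁₃ x x Bool.≟ false)
  }

C₁₃-path : ∀ i → Adj C₁₃ (inject₁ i) (suc i)
C₁₃-path = from-yes (FinP.all? λ i → adj₁₃ (inject₁ i) (suc i) Bool.≟ true)

C₁₃-independence : ∀ xs → Independent C₁₃ xs → length xs ≤ 3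
C₁₃-independence []                    _ = z≤n
C₁₃-independence (_ ∷ [])              _ = s≤s z≤n
C₁₃-independence (_ ∷ _ ∷ [])          _ = s≤s (s≤s z≤n)
C₁₃-independence (_ ∷ _ ∷ _ ∷ [])      _ = s≤s (s≤s (s≤s z≤n))
C₁₃-independence (a ∷ b ∷ c ∷ d ∷ xs)
  ((a≢b ∷ a≢c ∷ a≢d ∷ _) ∷ (b≢c ∷ b≢d ∷ _) ∷ (c≢d ∷ _) ∷ _ , indep) =
  contradiction (trans (sym (indep c∈ d∈)) (c~d a b a≢b (indep a∈ b∈) c a≢c b≢c (indep a∈ c∈) (indep b∈ c∈)
                                              d a≢d b≢d c≢d (indep a∈ d∈) (indep b∈ d∈))) λ ()
  where
  c~d : ∀ a b → a ≢ b → adj₁₃ a b ≡ false →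
        ∀ c → a ≢ c → b ≢ c → adj₁₃ a c ≡ false → adj₁₃ b c ≡ false →
        ∀ d → a ≢ d → b ≢ d → c ≢ d → adj₁₃ a d ≡ false → adj₁₃ b d ≡ false → adj₁₃ c d ≡ true
  c~d = from-yes (FinP.all? λ a → FinP.all? λ b → ¬? (a ≟ b) →-dec (adj₁₃ a b Bool.≟ false) →-dec
    FinP.all? λ c → ¬? (a ≟ c) →-dec ¬? (b ≟ c) →-dec
      (adj₁₃ a c Bool.≟ false) →-dec (adj₁₃ b c Bool.≟ false) →-dec
    FinP.all? λ d → ¬? (a ≟ d) →-dec ¬? (b ≟ d) →-dec ¬? (c ≟ d) →-dec (adj₁₃ a d Bool.≟ false) →-dec
      (adj₁₃ b d Bool.≟ false) →-dec (adj₁₃ c d Bool.≟ true))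
  a∈ : a ∈ a ∷ b ∷ c ∷ d ∷ xs
  a∈ = here refl
  b∈ : b ∈ a ∷ b ∷ c ∷ d ∷ xs
  b∈ = there (here refl)
  c∈ : c ∈ a ∷ b ∷ c ∷ d ∷ xs
  c∈ = there (there (here refl))
  d∈ : d ∈ a ∷ b ∷ c ∷ d ∷ xs
  d∈ = there (there (there (here refl)))

C₁₃-¬4-colourable : ¬ Colourable 4 C₁₃
C₁₃-¬4-colourable = ¬colourable-by-independence C₁₃ C₁₃-independence ℕP.≤-refl

C₁₃-K₄-free : ¬ ContainsSubgraph C₁₃ (complete 4)
C₁₃-K₄-free (f , _ , f-hom) =
  contradiction (trans (sym (c~d (f 0F) (f 1F) (f-hom 0F 1F refl) (f 2F) (f-hom 0F 2F refl) (f-hom 1F 2F refl)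
                                  (f 3F) (f-hom 0F 3F refl) (f-hom 1F 3F refl)))
                       (f-hom 2F 3F refl)) λ ()
  where
  c~d : ∀ a b → adj₁₃ a b ≡ true → ∀ c → adj₁₃ a c ≡ true → adj₁₃ b c ≡ true →
        ∀ d → adj₁₃ a d ≡ true → adj₁₃ b d ≡ true → adj₁₃ c d ≡ false
  c~d = from-yes (FinP.all? λ a → FinP.all? λ b → (adj₁₃ a b Bool.≟ true) →-dec
    FinP.all? λ c → (adj₁₃ a c Bool.≟ true) →-dec (adj₁₃ b c Bool.≟ true) →-dec
    FinP.all? λ d → (adj₁₃ a d Bool.≟ true) →-dec (adj₁₃ b d Bool.≟ true) →-dec (adj₁₃ c d Bool.≟ false))

C₁₃-colouring : Colourable 5 C₁₃
C₁₃-colouring = colour , from-yes (FinP.all? λ x → FinP.all? λ y →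
  (adj₁₃ x y Bool.≟ true) →-dec ¬? (colour x ≟ colour y))
  where
  colour : Fin 13 → Fin 5
  colour = List.lookup (# 0 ∷ # 1 ∷ # 0 ∷ # 1 ∷ # 2 ∷ # 3 ∷ # 2 ∷ # 0 ∷ # 1 ∷ # 4 ∷ # 3 ∷ # 2 ∷ # 3 ∷ [])

_⊕_ : Fin 13 → ℕ → Fin 13
x ⊕ d = (toℕ x + d) mod 13

-- Around every vertex x the neighbours x + d follow each other in the order d = 1, 4, 3, 12, 9, 10;
-- the ear sits in the face 0 → 12 → 3, after 0 around 12 and after 3 around 0.
rot₁₃ : Fin 13 → Maybe (Fin 13) → Maybe (Fin 13)
rot₁₃ zero    nothing  = just (# 12)
rot₁₃ (suc _) nothing  = just (# 3)
rot₁₃ x       (just y) = turn (y ⊖ x)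
  where
  turn : ℕ → Maybe (Fin 13)
  turn 1  = if does (x ≟ # 12) then nothing else just (x ⊕ 4)
  turn 4  = just (x ⊕ 3)
  turn 3  = if does (x ≟ # 0) then nothing else just (x ⊕ 12)
  turn 12 = just (x ⊕ 9)
  turn 9  = just (x ⊕ 10)
  turn 10 = just (x ⊕ 1)
  turn _  = nothing

C₁₃-rotation : Stub.Rotation C₁₃
C₁₃-rotation = record
  { rot        = rot₁₃
  ; rot-closed = from-yes (FinP.all? λ x → maybe-all? λ o →
                   (adj⁺ x o Bool.≟ true) →-dec (adj⁺ x (rot₁₃ x o) Bool.≟ true))
  ; rot-cyclic = λ x o o′ x~o x~o′ → Product.map toℕ id (orbit x o o′ x~o x~o′)
  }
  where
  open Stub C₁₃ using (adj⁺)
  orbit : ∀ x o o′ → adj⁺ x o ≡ true → adj⁺ x o′ ≡ true → Σ[ r ∈ Fin 7 ] iter (toℕ r) (rot₁₃ x) o ≡ o′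
  orbit = from-yes (FinP.all? λ x → maybe-all? λ o → maybe-all? λ o′ →
    (adj⁺ x o Bool.≟ true) →-dec (adj⁺ x o′ Bool.≟ true) →-dec
    FinP.any? {n = 7} λ r → MaybeP.≡-dec _≟_ (iter (toℕ r) (rot₁₃ x) o) o′)

C₁₃-inside : Stub.InsideFace C₁₃ C₁₃-rotation (# 3)
C₁₃-inside = record
  { rot-last-zero = refl
  ; rot-zero-stub = refl
  ; rot-last-stub = refl
  ; rot-c-last    = refl
  ; rot-zero-c    = refl
  ; c≢zero        = λ ()
  }

-- Both sides are 78: C₁₃(1, 3, 4) has 39 edges and 26 triangular faces, one of which holds the ear.
C₁₃-euler : length (darts C₁₃) ≤ 2 * (13 + 1 + length (Stub.triangleReps C₁₃ C₁₃-rotation))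
C₁₃-euler = ℕP.≤-refl

theorem4 : Σ (ℕ → Σ ℕ Graph) λ 𝒢 →
             (∀ i → Hamiltonian (proj₂ (𝒢 i))
                    × EmbedsOnTorus (proj₂ (𝒢 i))
                    × ¬ ContainsSubgraph (proj₂ (𝒢 i)) K5⁻
                    × ChromaticNumber (proj₂ (𝒢 i)) 5)
             × (∀ i j → i ≢ j → ¬ Iso (proj₂ (𝒢 i)) (proj₂ (𝒢 j)))
theorem4 = (λ k → _ , Ear.graph C₁₃ k) , properties , non-isomorphic
  where
  properties : ∀ k → Hamiltonian (Ear.graph C₁₃ k) × EmbedsOnTorus (Ear.graph C₁₃ k)
                    × ¬ ContainsSubgraph (Ear.graph C₁₃ k) K5⁻ × ChromaticNumber (Ear.graph C₁₃ k) 5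
  properties k =
      Ear.hamiltonian C₁₃ k C₁₃-path
    , Ear.embedsOnTorus C₁₃ k C₁₃-rotation C₁₃-inside C₁₃-path C₁₃-euler
    , K₄-free⇒K₅⁻-free (Ear.graph C₁₃ k) (Ear.K₄-free C₁₃ k C₁₃-K₄-free)
    , chromaticNumber-intro {G = Ear.graph C₁₃ k}
        (Ear.colourable C₁₃ k C₁₃-colouring (# 1) (# 2) (λ ()) (((λ ()) , (λ ())) ∷ ((λ ()) , (λ ())) ∷ []))
        (C₁₃-¬4-colourable ∘ colourable-sub {G = Ear.graph C₁₃ k} {H = C₁₃} (Ear.contains-H C₁₃ k))
  non-isomorphic : ∀ i j → i ≢ j → ¬ Iso (Ear.graph C₁₃ i) (Ear.graph C₁₃ j)
  non-isomorphic i j i≢j (σ , _) = i≢j (ℕP.suc-injective (ℕP.+-cancelˡ-≡ 13 _ _ (↔⇒≡ σ)))
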